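{- Let $G=(V,E)$ be a finite simple undirected graph with a vertex coloring $c:V\to C$. For a color $c\in C$ let $V_c$ be the set of vertices of color $c$, and define $$s_c=\max_{V'\subseteq V_c}\bigl(|V'|-|N_{C\setminus\{c\}}(V')|\bigr).$$ Then every feasible solution $G''=(V,E'')$, $E''\subseteq E$, in which every connected component is colorful, contains at least $s_c$ singleton vertices of color $c$ (vertices of color $c$ that are isolated in $G''$).
   Context: For $V'\subseteq V$, $N(V')=\{v\in V\setminus V' : \exists v'\in V',\ (v',v)\in E\}$ is the set of neighbors of $V'$ in $G$, and for $C'\subseteq C$, $N_{C'}(V')=\{v\in N(V') : c(v)\in C'\}$. A connected component is colorful if no two of its vertices share a color. -}

module Defs where

open import Data.Bool using (Bool; true; false; _∧_; _∨_; not)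
open import Data.Nat using (ℕ; zero; suc; _∸_; _⊔_)
open import Data.Fin using (Fin; _≟_)
open import Data.Fin.Subset using (Subset; ∣_∣; _⊆_; _∈_)
open import Data.Fin.Subset.Properties using (_⊆?_)
open import Data.Vec using (Vec; []; _∷_; tabulate; lookup)
open import Data.List using (List; []; _∷_; map; filter; foldr; _++_)
open import Relation.Nullary.Decidable using (⌊_⌋)
open import Relation.Binary.PropositionalEquality using (_≡_)
open import Relation.Binary.Construct.Closure.ReflexiveTransitive using (Star)

record Graph (n : ℕ) : Set where
  field
    adj     : Fin n → Fin n → Bool
    adj-sym : ∀ u v → adj u v ≡ adj v u
    irrefl  : ∀ v → adj v v ≡ false
open Graph public

anyFin : ∀ {n} → (Fin n → Bool) → Bool
anyFin {zero}  p = false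
anyFin {suc n} p = p Fin.zero ∨ anyFin (λ i → p (Fin.suc i))

_⊑_ : ∀ {n} → Graph n → Graph n → Set
H ⊑ G = ∀ u v → adj H u v ≡ true → adj G u v ≡ true

Connected : ∀ {n} → Graph n → Fin n → Fin n → Set
Connected H = Star (λ u v → adj H u v ≡ true)

AllComponentsColorful : ∀ {n k} → Graph n → (Fin n → Fin k) → Set
AllComponentsColorful H col =
  ∀ u v → Connected H u v → col u ≡ col v → u ≡ v

colorClass : ∀ {n k} → (Fin n → Fin k) → Fin k → Subset n
colorClass col c = tabulate (λ v → ⌊ col v ≟ c ⌋)

nbrsOtherColor : ∀ {n k} → Graph n → (Fin n → Fin k) → Fin k → Subset n → Subset n
nbrsOtherColor G col c V' =
  tabulate (λ v → not (lookup V' v) ∧ not ⌊ col v ≟ c ⌋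
                  ∧ anyFin (λ u → lookup V' u ∧ adj G u v))

allSubsets : ∀ n → List (Subset n)
allSubsets zero    = [] ∷ []
allSubsets (suc n) = map (false ∷_) (allSubsets n) ++ map (true ∷_) (allSubsets n)

maxList : List ℕ → ℕ
maxList = foldr _⊔_ 0

-- s_c = max_{V' ⊆ V_c} (|V'| - |N_{C\{c}}(V')|).
-- (The maximum is ≥ 0 since V' = ∅ is allowed, so truncated
--  subtraction gives the same maximum.)
s : ∀ {n k} → Graph n → (Fin n → Fin k) → Fin k → ℕ
s G col c =
  maxList (map (λ V' → ∣ V' ∣ ∸ ∣ nbrsOtherColor G col c V' ∣)
               (filter (λ V' → V' ⊆? colorClass col c) (allSubsets _)))

singletons : ∀ {n k} → Graph n → (Fin n → Fin k) → Fin k → ℕ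
singletons H col c =
  ∣ tabulate (λ v → ⌊ col v ≟ c ⌋ ∧ not (anyFin (adj H v))) ∣

-- Fix V' ⊆ V_c. A vertex of V' that is not isolated in G'' has a G''-neighbour; since
-- components of G'' are colorful, that neighbour has a color other than c, so it lies
-- outside V' and (as E'' ⊆ E) in N_{C∖{c}}(V'). Two vertices of V' with a common
-- neighbour would be same-colored vertices of one component, so choosing a neighbour is
-- injective. Hence at most |N_{C∖{c}}(V')| vertices of V' are non-isolated, and the
-- remaining |V'| − |N_{C∖{c}}(V')| are singletons of color c.
module Submission where

open import Defs
open import Data.Bool using (Bool; true; false; _∧_; _∨_; not)
open import Data.Bool.Properties using (∨-zeroʳ; ¬-not; T-≡)
open import Data.Fin using (Fin; zero; suc; _≟_)
open import Data.Fin.Properties using (0≢1+n; suc-injective)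
open import Data.Fin.Subset using (Subset; inside; outside; ∣_∣; _⊆_; _∈_; _∉_; _∪_; _∩_; _-_)
open import Data.Fin.Subset.Properties
  using (_⊆?_; p⊆q⇒∣p∣≤∣q∣; x∈p∩q⁺; x∈p∩q⁻; x∈p∪q⁺; x∈p∧x≢y⇒x∈p-y; x∈p⇒∣p-x∣<∣p∣)
open import Data.List using (List)
open import Data.List.Properties using (foldr-preservesᵇ)
open import Data.List.Relation.Unary.All as All using (All)
open import Data.List.Relation.Unary.All.Properties using (map⁺; all-filter)
open import Data.Nat using (ℕ; _≤_; _+_; _∸_; z≤n; s≤s)
open import Data.Nat.Properties using (≤-refl; ≤-reflexive; ≤-trans; +-mono-≤; +-suc; n≤1+n; ⊔-lub; m≤n+o⇒m∸n≤o)
open import Data.Product using (∃; _,_; proj₁; proj₂)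
open import Data.Sum using (inj₁; inj₂)
open import Data.Vec using (_∷_; []; here; there; tabulate; lookup)
open import Data.Vec.Properties using (lookup∘tabulate; []=⇒lookup; lookup⇒[]=)
open import Function using (_∘_)
open import Function.Bundles using (Equivalence)
open import Relation.Nullary using (¬_; Dec)
open import Relation.Nullary.Decidable using (⌊_⌋; toWitness; isYes≗does; dec-true; dec-false)
open import Relation.Binary.PropositionalEquality using (_≡_; _≢_; refl; sym; trans; cong; cong₂; subst; module ≡-Reasoning)
open import Relation.Binary.Construct.Closure.ReflexiveTransitive using (ε; _◅_)

private
  variable
    m n k : ℕ

∣p∪q∣≤∣p∣+∣q∣ : (p q : Subset n) → ∣ p ∪ q ∣ ≤ ∣ p ∣ + ∣ q ∣
∣p∪q∣≤∣p∣+∣q∣ []              []              = z≤n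
∣p∪q∣≤∣p∣+∣q∣ (outside ∷ p) (outside ∷ q) = ∣p∪q∣≤∣p∣+∣q∣ p q
∣p∪q∣≤∣p∣+∣q∣ (outside ∷ p) (inside ∷ q)  =
  ≤-trans (s≤s (∣p∪q∣≤∣p∣+∣q∣ p q)) (≤-reflexive (sym (+-suc ∣ p ∣ ∣ q ∣)))
∣p∪q∣≤∣p∣+∣q∣ (inside ∷ p)  (outside ∷ q) = s≤s (∣p∪q∣≤∣p∣+∣q∣ p q)
∣p∪q∣≤∣p∣+∣q∣ (inside ∷ p)  (inside ∷ q)  =
  s≤s (≤-trans (∣p∪q∣≤∣p∣+∣q∣ p q) (+-mono-≤ ≤-refl (n≤1+n ∣ q ∣)))

p⊆q∪r⇒∣p∣≤∣q∣+∣r∣ : {p q r : Subset n} → p ⊆ q ∪ r → ∣ p ∣ ≤ ∣ q ∣ + ∣ r ∣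
p⊆q∪r⇒∣p∣≤∣q∣+∣r∣ {q = q} {r} p⊆q∪r = ≤-trans (p⊆q⇒∣p∣≤∣q∣ p⊆q∪r) (∣p∪q∣≤∣p∣+∣q∣ q r)

injection⇒∣p∣≤∣q∣ : {p : Subset m} {q : Subset n} (f : ∀ {x} → x ∈ p → Fin n) →
                    (∀ {x} (x∈p : x ∈ p) → f x∈p ∈ q) →
                    (∀ {x y} (x∈p : x ∈ p) (y∈p : y ∈ p) → f x∈p ≡ f y∈p → x ≡ y) →
                    ∣ p ∣ ≤ ∣ q ∣
injection⇒∣p∣≤∣q∣ {p = []}          f f∈q f-inj = z≤n
injection⇒∣p∣≤∣q∣ {p = outside ∷ p} f f∈q f-inj =
  injection⇒∣p∣≤∣q∣ (f ∘ there) (f∈q ∘ there)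
    (λ x∈p y∈p → suc-injective ∘ f-inj (there x∈p) (there y∈p))
injection⇒∣p∣≤∣q∣ {p = inside ∷ p}  {q} f f∈q f-inj =
  ≤-trans (s≤s ∣p∣≤∣q-f₀∣) (x∈p⇒∣p-x∣<∣p∣ (f∈q here))
  where
  ∣p∣≤∣q-f₀∣ : ∣ p ∣ ≤ ∣ q - f here ∣
  ∣p∣≤∣q-f₀∣ = injection⇒∣p∣≤∣q∣ (f ∘ there)
    (λ x∈p → x∈p∧x≢y⇒x∈p-y (f∈q (there x∈p))
               (0≢1+n ∘ f-inj here (there x∈p) ∘ sym))
    (λ x∈p y∈p → suc-injective ∘ f-inj (there x∈p) (there y∈p))

∈-tabulate⁺ : {f : Fin n → Bool} {x : Fin n} → f x ≡ true → x ∈ tabulate f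
∈-tabulate⁺ {f = f} {x} fx = lookup⇒[]= x (tabulate f) (trans (lookup∘tabulate f x) fx)

∈-tabulate⁻ : {f : Fin n → Bool} {x : Fin n} → x ∈ tabulate f → f x ≡ true
∈-tabulate⁻ {f = f} {x} x∈f = trans (sym (lookup∘tabulate f x)) ([]=⇒lookup x∈f)

∉⇒lookup≡false : {p : Subset n} {x : Fin n} → x ∉ p → lookup p x ≡ false
∉⇒lookup≡false {p = p} {x} x∉p = ¬-not (x∉p ∘ lookup⇒[]= x p)

anyFin⁺ : (p : Fin n → Bool) (i : Fin n) → p i ≡ true → anyFin p ≡ true
anyFin⁺ p zero    pi = cong (_∨ anyFin (p ∘ suc)) pi
anyFin⁺ p (suc i) pi = trans (cong (p zero ∨_) (anyFin⁺ (p ∘ suc) i pi)) (∨-zeroʳ (p zero))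

anyFin⁻ : (p : Fin n → Bool) → anyFin p ≡ true → ∃ λ i → p i ≡ true
anyFin⁻ {n = ℕ.suc n} p any with p zero in p₀
... | true  = zero , p₀
... | false = let i , pi = anyFin⁻ (p ∘ suc) any in suc i , pi

⌊⌋-true : {P : Set} (P? : Dec P) → P → ⌊ P? ⌋ ≡ true
⌊⌋-true P? p = trans (isYes≗does P?) (dec-true P? p)

⌊⌋-false : {P : Set} (P? : Dec P) → ¬ P → ⌊ P? ⌋ ≡ false
⌊⌋-false P? ¬p = trans (isYes≗does P?) (dec-false P? ¬p)

maxList-≤ : {b : ℕ} {xs : List ℕ} → All (_≤ b) xs → maxList xs ≤ b
maxList-≤ = foldr-preservesᵇ ⊔-lub z≤n

adjacent⇒≢ : (H : Graph n) {u v : Fin n} → adj H u v ≡ true → u ≢ v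
adjacent⇒≢ H {u} huu refl with trans (sym huu) (irrefl H u)
... | ()

module Colorful {H : Graph n} {col : Fin n → Fin k} (colorful : AllComponentsColorful H col) where

  adjacent⇒col≢ : {u v : Fin n} → adj H u v ≡ true → col u ≢ col v
  adjacent⇒col≢ huv = adjacent⇒≢ H huv ∘ colorful _ _ (huv ◅ ε)

  commonNeighbour⇒≡ : {u v w : Fin n} → adj H u w ≡ true → adj H v w ≡ true →
                      col u ≡ col v → u ≡ v
  commonNeighbour⇒≡ {v = v} {w} huw hvw = colorful _ _ (huw ◅ trans (adj-sym H w v) hvw ◅ ε)

∈colorClass⁻ : {col : Fin n → Fin k} {c : Fin k} {x : Fin n} → x ∈ colorClass col c → col x ≡ c
∈colorClass⁻ = toWitness ∘ Equivalence.from T-≡ ∘ ∈-tabulate⁻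

∈nbrsOtherColor⁺ : (G : Graph n) {col : Fin n → Fin k} {c : Fin k} {V' : Subset n} {u v : Fin n} →
                   u ∉ V' → col u ≢ c → v ∈ V' → adj G v u ≡ true →
                   u ∈ nbrsOtherColor G col c V'
∈nbrsOtherColor⁺ G {col} {c} {V'} {u} {v} u∉V' colu≢c v∈V' guv = ∈-tabulate⁺ (begin
    not (lookup V' u) ∧ not ⌊ col u ≟ c ⌋ ∧ adjacentToV'
  ≡⟨ cong₂ (λ a b → not a ∧ not b ∧ adjacentToV') (∉⇒lookup≡false u∉V') (⌊⌋-false (col u ≟ c) colu≢c) ⟩
    adjacentToV'
  ≡⟨ anyFin⁺ _ v (cong₂ _∧_ ([]=⇒lookup v∈V') guv) ⟩
    true ∎)
  where
  open ≡-Reasoning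
  adjacentToV' : Bool
  adjacentToV' = anyFin (λ w → lookup V' w ∧ adj G w u)

nonIsolated : Graph n → Subset n
nonIsolated H = tabulate (anyFin ∘ adj H)

singletonVertices : Graph n → (Fin n → Fin k) → Fin k → Subset n
singletonVertices H col c = tabulate (λ v → ⌊ col v ≟ c ⌋ ∧ not (anyFin (adj H v)))

neighbour : (H : Graph n) {x : Fin n} → x ∈ nonIsolated H → Fin n
neighbour H {x} = proj₁ ∘ anyFin⁻ (adj H x) ∘ ∈-tabulate⁻

adj-neighbour : (H : Graph n) {x : Fin n} (x∈ : x ∈ nonIsolated H) → adj H x (neighbour H x∈) ≡ true
adj-neighbour H {x} = proj₂ ∘ anyFin⁻ (adj H x) ∘ ∈-tabulate⁻

module _ (G : Graph n) (col : Fin n → Fin k) (c : Fin k) (H : Graph n)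
         (H⊑G : H ⊑ G) (colorful : AllComponentsColorful H col)
         {V' : Subset n} (V'⊆Vc : V' ⊆ colorClass col c) where

  open Colorful {H = H} {col = col} colorful

  private
    col≡c : {x : Fin n} → x ∈ V' → col x ≡ c
    col≡c = ∈colorClass⁻ ∘ V'⊆Vc

  V'⊆nonIsolated∪singletons : V' ⊆ (V' ∩ nonIsolated H) ∪ singletonVertices H col c
  V'⊆nonIsolated∪singletons {x} x∈V' with anyFin (adj H x) in hasNeighbour
  ... | true  = x∈p∪q⁺ (inj₁ (x∈p∩q⁺ (x∈V' , ∈-tabulate⁺ hasNeighbour)))
  ... | false = x∈p∪q⁺ (inj₂ (∈-tabulate⁺
                  (cong₂ _∧_ (⌊⌋-true (col x ≟ c) (col≡c x∈V')) (cong not hasNeighbour))))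

  ∣V'∩nonIsolated∣≤∣nbrsOtherColor∣ : ∣ V' ∩ nonIsolated H ∣ ≤ ∣ nbrsOtherColor G col c V' ∣
  ∣V'∩nonIsolated∣≤∣nbrsOtherColor∣ = injection⇒∣p∣≤∣q∣ f f∈N f-injective
    where
    ∈V' : {x : Fin n} → x ∈ V' ∩ nonIsolated H → x ∈ V'
    ∈V' x∈A = proj₁ (x∈p∩q⁻ V' (nonIsolated H) x∈A)

    f : {x : Fin n} → x ∈ V' ∩ nonIsolated H → Fin n
    f x∈A = neighbour H (proj₂ (x∈p∩q⁻ V' (nonIsolated H) x∈A))

    adj-f : {x : Fin n} (x∈A : x ∈ V' ∩ nonIsolated H) → adj H x (f x∈A) ≡ true
    adj-f x∈A = adj-neighbour H (proj₂ (x∈p∩q⁻ V' (nonIsolated H) x∈A))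

    f∈N : {x : Fin n} (x∈A : x ∈ V' ∩ nonIsolated H) → f x∈A ∈ nbrsOtherColor G col c V'
    f∈N x∈A = ∈nbrsOtherColor⁺ G (colf≢c ∘ col≡c) colf≢c (∈V' x∈A) (H⊑G _ _ (adj-f x∈A))
      where
      colf≢c : col (f x∈A) ≢ c
      colf≢c colf≡c = adjacent⇒col≢ (adj-f x∈A) (trans (col≡c (∈V' x∈A)) (sym colf≡c))

    f-injective : {x y : Fin n} (x∈A : x ∈ V' ∩ nonIsolated H) (y∈A : y ∈ V' ∩ nonIsolated H) →
                  f x∈A ≡ f y∈A → x ≡ y
    f-injective x∈A y∈A fx≡fy =
      commonNeighbour⇒≡ (adj-f x∈A) (subst (λ w → adj H _ w ≡ true) (sym fx≡fy) (adj-f y∈A))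
        (trans (col≡c (∈V' x∈A)) (sym (col≡c (∈V' y∈A))))

  ∣V'∣≤∣nbrsOtherColor∣+singletons : ∣ V' ∣ ≤ ∣ nbrsOtherColor G col c V' ∣ + singletons H col c
  ∣V'∣≤∣nbrsOtherColor∣+singletons =
    ≤-trans (p⊆q∪r⇒∣p∣≤∣q∣+∣r∣ V'⊆nonIsolated∪singletons)
            (+-mono-≤ ∣V'∩nonIsolated∣≤∣nbrsOtherColor∣ ≤-refl)

lemma1 : ∀ {n k : ℕ} (G : Graph n) (col : Fin n → Fin k) (c : Fin k)
           (G'' : Graph n) → G'' ⊑ G → AllComponentsColorful G'' col →
           s G col c ≤ singletons G'' col c
lemma1 G col c G'' G''⊑G colorful =
  maxList-≤ (map⁺ (All.map bound (all-filter (_⊆? colorClass col c) (allSubsets _))))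
  where
  bound : ∀ {V'} → V' ⊆ colorClass col c →
          ∣ V' ∣ ∸ ∣ nbrsOtherColor G col c V' ∣ ≤ singletons G'' col c
  bound V'⊆Vc = m≤n+o⇒m∸n≤o _ _ (∣V'∣≤∣nbrsOtherColor∣+singletons G col c G'' G''⊑G colorful V'⊆Vc)
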